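{- Let $u,v\in S_n$, $\mathbf{a}\in[n]^n$, and $i\in[n-1]$. If $u\lesssim_{\mathbf{a}}v$ and $i\in\mathrm{Des}_{\mathbf{a}}(v)\cap\mathrm{Asc}_{\mathbf{a}}(u)$, then $us_i\lesssim_{\mathbf{a}}v$ and $u\lesssim_{\mathbf{a}}vs_i$.
   Context: Permutations are in one-line notation $w=w_1\cdots w_n$, $w[k]:=\{w_1,\dots,w_k\}$; $ws_i$ is obtained from $w$ by swapping the entries in positions $i$ and $i+1$. Cyclic interval $[a,b)_c$: $\{a,\dots,b-1\}$ if $a\le b$, $\{a,\dots,n\}\cup\{1,\dots,b-1\}$ if $a>b$. For $r\in[n]$, $<_r$ is the total order $r<_r r+1<_r\cdots<_r n<_r 1<_r\cdots<_r r-1$ on $[n]$; for $k$-subsets $A=\{a_1<_r\cdots<_r a_k\}$, $B=\{b_1<_r\cdots<_r b_k\}$, $A\le_r B$ means $a_i\le_r b_i$ for all $i$. For $\mathbf{a}=(a_1,\dots,a_n)\in[n]^n$: $u\lesssim_{\mathbf{a}}v$ iff $u[k]\le_{a_k}v[k]$ for all $k\in[n]$ and $|u[k]\cap[a_k,a_{k+1})_c|=|v[k]\cap[a_k,a_{k+1})_c|$ for all $k\in[n-1]$. The $\mathbf{a}$-descent and $\mathbf{a}$-ascent sets are $\mathrm{Des}_{\mathbf{a}}(w):=\{i\in[n-1]:a_i=a_{i+1},\ w_i>_{a_i}w_{i+1}\}$ and $\mathrm{Asc}_{\mathbf{a}}(w):=\{i\in[n-1]:a_i=a_{i+1},\ w_i<_{a_i}w_{i+1}\}$.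 -}

module Defs where

open import Data.Nat using (ℕ; zero; suc; _+_; _∸_; _≤_; _<_; _≤ᵇ_; _<ᵇ_)
open import Data.Nat.Properties using (≤-decTotalOrder)
open import Data.Bool using (Bool; true; false; if_then_else_; _∧_; _∨_)
open import Data.Fin using (Fin; toℕ)
open import Data.Fin.Permutation using (Permutation′; _⟨$⟩ʳ_; _∘ₚ_; transpose)
open import Data.List using (List; map; take; filterᵇ; length; allFin)
open import Data.List.Relation.Binary.Pointwise using (Pointwise)
open import Data.Product using (_×_)
open import Relation.Binary.PropositionalEquality using (_≡_)
import Data.List.Sort.InsertionSort as IS

-- Conventions: [n] is represented by Fin n via  x ↦ toℕ x + 1.
-- Positions 1..n are Fin n (position p is toℕ p + 1).
-- A permutation w ∈ S_n is  Permutation′ n ; w_p = w ⟨$⟩ʳ p.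

oneLine : ∀ {n} → Permutation′ n → List (Fin n)
oneLine {n} w = map (w ⟨$⟩ʳ_) (allFin n)

prefix : ∀ {n} → Permutation′ n → ℕ → List (Fin n)
prefix w k = take k (oneLine w)

-- w s_i  (swap entries in positions p and q; used with q = p+1)
swapPos : ∀ {n} → Permutation′ n → Fin n → Fin n → Permutation′ n
swapPos w p q = transpose p q ∘ₚ w

-- rank of x in the order <_r : r ↦ 0, r+1 ↦ 1, …, r-1 ↦ n-1.
-- So x <_r y  iff  rank r x < rank r y.
rank : ∀ {n} → Fin n → Fin n → ℕ
rank {n} r x = if toℕ r ≤ᵇ toℕ x then toℕ x ∸ toℕ r else (toℕ x + n) ∸ toℕ r

_<[_]_ : ∀ {n} → Fin n → Fin n → Fin n → Set
x <[ r ] y = rank r x < rank r y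

-- The elements of a k-subset listed increasingly w.r.t. <_r, represented by their ranks.
sortedRanks : ∀ {n} → Fin n → List (Fin n) → List ℕ
sortedRanks r A = IS.sort ≤-decTotalOrder (map (rank r) A)

_≤[_]ˢ_ : ∀ {n} → List (Fin n) → Fin n → List (Fin n) → Set
A ≤[ r ]ˢ B = Pointwise _≤_ (sortedRanks r A) (sortedRanks r B)

inCyc : ∀ {n} → Fin n → Fin n → Fin n → Bool
inCyc a b x = if toℕ a ≤ᵇ toℕ b
              then (toℕ a ≤ᵇ toℕ x) ∧ (toℕ x <ᵇ toℕ b)
              else (toℕ a ≤ᵇ toℕ x) ∨ (toℕ x <ᵇ toℕ b)

countCyc : ∀ {n} → Fin n → Fin n → List (Fin n) → ℕ
countCyc a b A = length (filterᵇ (inCyc a b) A)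

-- u ≲_a v.  a : Fin n → Fin n, with a_k = a p where toℕ p + 1 = k.
_≲[_]_ : ∀ {n} → Permutation′ n → (Fin n → Fin n) → Permutation′ n → Set
_≲[_]_ {n} u a v =
  (∀ (p : Fin n) → prefix u (suc (toℕ p)) ≤[ a p ]ˢ prefix v (suc (toℕ p)))
  × (∀ (p q : Fin n) → toℕ q ≡ suc (toℕ p) →
       countCyc (a p) (a q) (prefix u (suc (toℕ p)))
         ≡ countCyc (a p) (a q) (prefix v (suc (toℕ p))))

-- i ∈ Des_a(w), with position i = p and i+1 = q (toℕ q ≡ suc (toℕ p))
IsDes : ∀ {n} → (Fin n → Fin n) → Permutation′ n → Fin n → Fin n → Set
IsDes a w p q = (a p ≡ a q) × ((w ⟨$⟩ʳ q) <[ a p ] (w ⟨$⟩ʳ p))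

IsAsc : ∀ {n} → (Fin n → Fin n) → Permutation′ n → Fin n → Fin n → Set
IsAsc a w p q = (a p ≡ a q) × ((w ⟨$⟩ʳ p) <[ a p ] (w ⟨$⟩ʳ q))

-- The Gale order S ≤_r T of k-sets says that every initial segment of <_r contains at least as many
-- elements of S as of T. Swapping the entries in positions i, i+1 changes only the i-th prefix, and
-- the interval condition there is vacuous because a_i = a_{i+1}. The new i-th Gale conditions follow
-- by counting from u[i+1] ≤ v[i+1] and u[i-1] ≤ v[i-1] in the order <_{a_i}: an initial segment
-- containing u_{i+1} also contains u_i, and one containing v_i also contains v_{i+1}. The comparison of
-- u[i-1] and v[i-1] in <_{a_i} comes from the one in <_{a_{i-1}} by rotating the order, which preserves
-- the Gale order once the counts in [a_{i-1}, a_i)_c agree.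

{-# OPTIONS --safe #-}
module Submission where

open import Defs
open import Algebra.Properties.CommutativeSemigroup using (interchange)
open import Data.Bool using (Bool; true; false; if_then_else_)
open import Data.Fin using (Fin; toℕ; zero; suc; inject₁)
open import Data.Fin.Permutation using (Permutation′; _⟨$⟩ʳ_; lift₀-transpose)
import Data.Fin.Permutation.Components as PC
open import Data.Fin.Properties using (_≟_; toℕ<n; toℕ-inject₁; toℕ-injective)
open import Data.List using (List; []; _∷_; [_]; map; take; tabulate; filterᵇ; length)
open import Data.List.Properties using (length-map; map-tabulate; tabulate-cong; take-suc-tabulate)
open import Data.List.Relation.Binary.Permutation.Propositional
  using (_↭_; prep; swap; ↭-refl; ↭-sym; ↭-trans; ↭-reflexive; module PermutationReasoning)
open import Data.List.Relation.Binary.Permutation.Propositional.Properties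
  using (↭-length; filter-↭; ++-comm)
open import Data.List.Relation.Binary.Pointwise using (Pointwise; []; _∷_; Pointwise-length)
open import Data.List.Relation.Unary.All as All using (All; []; _∷_)
open import Data.List.Relation.Unary.AllPairs using (AllPairs; _∷_)
open import Data.List.Relation.Unary.Sorted.TotalOrder.Properties using (Sorted⇒AllPairs)
import Data.List.Sort.InsertionSort.Properties as InsertionSort
open import Data.Nat
  using (ℕ; zero; suc; _+_; _∸_; _*_; _%_; _⊓_; pred; _≤_; _<_; _≤ᵇ_; _<ᵇ_; z≤n; s≤s; s≤s⁻¹; NonZero)
open import Data.Nat.DivMod using (%-distribˡ-+; [m+kn]%n≡m%n; [m+n]%n≡m%n; m<n⇒m%n≡m)
open import Data.Nat.Properties hiding (_≟_)
open import Data.Nat.Tactic.RingSolver using (solve-∀)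
open import Data.Product using (_×_; _,_; proj₁; proj₂)
open import Function using (_∘_)
open import Relation.Binary.PropositionalEquality
  using (_≡_; _≢_; refl; sym; trans; cong; cong₂; subst; subst₂; module ≡-Reasoning)
open import Relation.Nullary using (yes; no; contradiction)
open import Relation.Nullary.Decidable using (T?; dec-true)
open import Relation.Nullary.Reflects using (of; det; fromEquivalence)

private
  variable
    A : Set
    m n k c x y : ℕ

bit : Bool → ℕ
bit false = 0
bit true  = 1

bit≤1 : ∀ b → bit b ≤ 1
bit≤1 false = z≤n
bit≤1 true  = ≤-refl

<ᵇ-true : m < n → (m <ᵇ n) ≡ true
<ᵇ-true m<n = det (<ᵇ-reflects-< _ _) (of m<n)

<ᵇ-false : n ≤ m → (m <ᵇ n) ≡ false
<ᵇ-false n≤m = det (<ᵇ-reflects-< _ _) (of (≤⇒≯ n≤m))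

≤ᵇ-true : m ≤ n → (m ≤ᵇ n) ≡ true
≤ᵇ-true m≤n = det (≤ᵇ-reflects-≤ _ _) (of m≤n)

≤ᵇ-false : n < m → (m ≤ᵇ n) ≡ false
≤ᵇ-false n<m = det (≤ᵇ-reflects-≤ _ _) (of (<⇒≱ n<m))

<ᵇ-cong : ∀ {m n m′ n′} → (m < n → m′ < n′) → (m′ < n′ → m < n) → (m <ᵇ n) ≡ (m′ <ᵇ n′)
<ᵇ-cong to from = det (<ᵇ-reflects-< _ _) (fromEquivalence (from ∘ <ᵇ⇒< _ _) (<⇒<ᵇ ∘ to))

m∸n<ᵇo≡m<ᵇo+n : ∀ o → n ≤ m → (m ∸ n <ᵇ o) ≡ (m <ᵇ o + n)
m∸n<ᵇo≡m<ᵇo+n {n} {m} o n≤m = <ᵇ-cong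
  (λ lt → subst (_< o + n) (m∸n+n≡m n≤m) (+-monoˡ-< n lt))
  (λ lt → +-cancelʳ-< n (m ∸ n) o (subst (_< o + n) (sym (m∸n+n≡m n≤m)) lt))

m+n<ᵇo≡m<ᵇo∸n : ∀ m n o → (m + n <ᵇ o) ≡ (m <ᵇ o ∸ n)
m+n<ᵇo≡m<ᵇo∸n m n o = <ᵇ-cong {m + n} {o} {m} {o ∸ n} (m+n≤o⇒m≤o∸n (suc m))
  (λ lt → m≤o∸n⇒m+n≤o (suc m) (<⇒≤ (m∸n≢0⇒n<m (n>0⇒n≢0 (≤-trans (s≤s z≤n) lt)))) lt)

m∸o<ᵇn∸o≡m<ᵇn : ∀ {m n o} → o ≤ m → o ≤ n → (m ∸ o <ᵇ n ∸ o) ≡ (m <ᵇ n)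
m∸o<ᵇn∸o≡m<ᵇn {m} {n} {o} o≤m o≤n = trans (m∸n<ᵇo≡m<ᵇo+n (n ∸ o) o≤m) (cong (m <ᵇ_) (m∸n+n≡m o≤n))

m+o<ᵇn+o≡m<ᵇn : ∀ m n o → (m + o <ᵇ n + o) ≡ (m <ᵇ n)
m+o<ᵇn+o≡m<ᵇn m n o = trans (m+n<ᵇo≡m<ᵇo∸n m o (n + o)) (cong (m <ᵇ_) (m+n∸n≡m n o))

bit-<ᵇ-antitone : ∀ k → x ≤ y → bit (y <ᵇ k) ≤ bit (x <ᵇ k)
bit-<ᵇ-antitone {x} {y} k x≤y with y <? k
... | yes y<k rewrite <ᵇ-true y<k | <ᵇ-true (≤-<-trans x≤y y<k) = ≤-refl
... | no  y≮k rewrite <ᵇ-false (≮⇒≥ y≮k) = z≤n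

count : (A → Bool) → List A → ℕ
count p []       = 0
count p (x ∷ xs) = bit (p x) + count p xs

length-filterᵇ : ∀ (p : A → Bool) xs → length (filterᵇ p xs) ≡ count p xs
length-filterᵇ p []       = refl
length-filterᵇ p (x ∷ xs) with p x
... | true  = cong suc (length-filterᵇ p xs)
... | false = length-filterᵇ p xs

count-↭ : ∀ (p : A → Bool) {xs ys} → xs ↭ ys → count p xs ≡ count p ys
count-↭ p {xs} {ys} xs↭ys = begin
  count p xs             ≡⟨ length-filterᵇ p xs ⟨
  length (filterᵇ p xs)  ≡⟨ ↭-length (filter-↭ (T? ∘ p) xs↭ys) ⟩
  length (filterᵇ p ys)  ≡⟨ length-filterᵇ p ys ⟩
  count p ys             ∎
  where open ≡-Reasoning

count-map : ∀ {B : Set} (p : B → Bool) (f : A → B) xs → count p (map f xs) ≡ count (p ∘ f) xs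
count-map p f []       = refl
count-map p f (x ∷ xs) = cong (bit (p (f x)) +_) (count-map p f xs)

count-cong : ∀ {p q : A → Bool} → (∀ x → p x ≡ q x) → ∀ xs → count p xs ≡ count q xs
count-cong p≗q []       = refl
count-cong p≗q (x ∷ xs) = cong₂ _+_ (cong bit (p≗q x)) (count-cong p≗q xs)

count-accept : ∀ {p : A → Bool} x xs → p x ≡ true → count p (x ∷ xs) ≡ suc (count p xs)
count-accept x xs px≡true rewrite px≡true = refl

count-none : ∀ {p : A → Bool} {xs} → All (λ x → p x ≡ false) xs → count p xs ≡ 0
count-none []             = refl
count-none (px≡false ∷ h) rewrite px≡false = count-none h

count-+ : ∀ {p q p′ q′ : A → Bool} → (∀ x → bit (p x) + bit (q x) ≡ bit (p′ x) + bit (q′ x)) →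
          ∀ xs → count p xs + count q xs ≡ count p′ xs + count q′ xs
count-+ e [] = refl
count-+ {p = p} {q} {p′} {q′} e (x ∷ xs) = begin
  (bit (p x) + count p xs) + (bit (q x) + count q xs)      ≡⟨ +-interchange (bit (p x)) _ (bit (q x)) _ ⟩
  (bit (p x) + bit (q x)) + (count p xs + count q xs)      ≡⟨ cong₂ _+_ (e x) (count-+ e xs) ⟩
  (bit (p′ x) + bit (q′ x)) + (count p′ xs + count q′ xs)  ≡⟨ +-interchange (bit (p′ x)) _ (count p′ xs) _ ⟩
  (bit (p′ x) + count p′ xs) + (bit (q′ x) + count q′ xs)  ∎
  where
  open ≡-Reasoning
  +-interchange : ∀ a b c d → (a + b) + (c + d) ≡ (a + c) + (b + d)
  +-interchange = interchange +-commutativeSemigroup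

-- The Gale order by counting

Pointwise-≤⇒count-≥ : ∀ {xs ys} → Pointwise _≤_ xs ys → ∀ k → count (_<ᵇ k) ys ≤ count (_<ᵇ k) xs
Pointwise-≤⇒count-≥ []            k = z≤n
Pointwise-≤⇒count-≥ (x≤y ∷ xs≤ys) k = +-mono-≤ (bit-<ᵇ-antitone k x≤y) (Pointwise-≤⇒count-≥ xs≤ys k)

count-<ᵇ-none : ∀ {xs} → All (k ≤_) xs → count (_<ᵇ k) xs ≡ 0
count-<ᵇ-none = count-none ∘ All.map <ᵇ-false

count-≥⇒Pointwise-≤ : ∀ {xs ys} → AllPairs _≤_ xs → AllPairs _≤_ ys → length xs ≡ length ys →
                      (∀ k → count (_<ᵇ k) ys ≤ count (_<ᵇ k) xs) → Pointwise _≤_ xs ys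
count-≥⇒Pointwise-≤ {[]}     {[]}     _ _ _ _ = []
count-≥⇒Pointwise-≤ {x ∷ xs} {y ∷ ys} (x≤xs ∷ xs↗) (y≤ys ∷ ys↗) |xs|≡|ys| dominated =
  x≤y ∷ count-≥⇒Pointwise-≤ xs↗ ys↗ (suc-injective |xs|≡|ys|) tail-dominated
  where
  x≤y : x ≤ y
  x≤y = ≮⇒≥ λ y<x → <-irrefl refl (begin-strict
    0                           <⟨ s≤s z≤n ⟩
    suc (count (_<ᵇ suc y) ys)  ≡⟨ count-accept y ys (<ᵇ-true (n<1+n y)) ⟨
    count (_<ᵇ suc y) (y ∷ ys)  ≤⟨ dominated (suc y) ⟩
    count (_<ᵇ suc y) (x ∷ xs)  ≡⟨ count-<ᵇ-none (y<x ∷ All.map (≤-trans y<x) x≤xs) ⟩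
    0                           ∎)
    where open ≤-Reasoning
  tail-dominated : ∀ k → count (_<ᵇ k) ys ≤ count (_<ᵇ k) xs
  tail-dominated k with y <? k
  ... | yes y<k = s≤s⁻¹ (subst₂ _≤_ (count-accept y ys (<ᵇ-true y<k))
                                    (count-accept x xs (<ᵇ-true (≤-<-trans x≤y y<k))) (dominated k))
  ... | no  y≮k = subst (_≤ _) (sym (count-<ᵇ-none (All.map (≤-trans (≮⇒≥ y≮k)) y≤ys))) z≤n

countBelow : ∀ {n} → Fin n → ℕ → List (Fin n) → ℕ
countBelow r k = count (λ x → rank r x <ᵇ k)

module _ {n} (r : Fin n) where
  open InsertionSort ≤-decTotalOrder using (sort-↭; sort-↗)

  count-sortedRanks : ∀ k S → count (_<ᵇ k) (sortedRanks r S) ≡ countBelow r k S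
  count-sortedRanks k S =
    trans (count-↭ (_<ᵇ k) (sort-↭ (map (rank r) S))) (count-map (_<ᵇ k) (rank r) S)

  length-sortedRanks : ∀ S → length (sortedRanks r S) ≡ length S
  length-sortedRanks S = trans (↭-length (sort-↭ (map (rank r) S))) (length-map (rank r) S)

  sortedRanks-↗ : ∀ S → AllPairs _≤_ (sortedRanks r S)
  sortedRanks-↗ S = Sorted⇒AllPairs ≤-totalOrder (sort-↗ (map (rank r) S))

infix 4 _≼[_]_

-- Equivalent to S ≤[ r ]ˢ T (≤ˢ⇒≼, ≼⇒≤ˢ); being a record, its indices can be inferred.
record _≼[_]_ {n} (S : List (Fin n)) (r : Fin n) (T : List (Fin n)) : Set where
  constructor dominates
  field
    length-≡  : length S ≡ length T
    dominated : ∀ k → countBelow r k T ≤ countBelow r k S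

≤ˢ⇒≼ : ∀ {n} (r : Fin n) {S T} → S ≤[ r ]ˢ T → S ≼[ r ] T
≤ˢ⇒≼ r {S} {T} S≤T = dominates
  (trans (sym (length-sortedRanks r S)) (trans (Pointwise-length S≤T) (length-sortedRanks r T)))
  (λ k → subst₂ _≤_ (count-sortedRanks r k T) (count-sortedRanks r k S) (Pointwise-≤⇒count-≥ S≤T k))

≼⇒≤ˢ : ∀ {n} {r : Fin n} {S T} → S ≼[ r ] T → S ≤[ r ]ˢ T
≼⇒≤ˢ {r = r} {S} {T} (dominates |S|≡|T| dominated) =
  count-≥⇒Pointwise-≤ (sortedRanks-↗ r S) (sortedRanks-↗ r T)
    (trans (length-sortedRanks r S) (trans |S|≡|T| (sym (length-sortedRanks r T))))
    (λ k → subst₂ _≤_ (sym (count-sortedRanks r k T)) (sym (count-sortedRanks r k S)) (dominated k))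

≼-resp-↭ : ∀ {n} {r : Fin n} {S S′ T T′} → S ↭ S′ → T ↭ T′ → S ≼[ r ] T → S′ ≼[ r ] T′
≼-resp-↭ S↭S′ T↭T′ (dominates |S|≡|T| dominated) = dominates
  (trans (sym (↭-length S↭S′)) (trans |S|≡|T| (↭-length T↭T′)))
  (λ k → subst₂ _≤_ (count-↭ _ T↭T′) (count-↭ _ S↭S′) (dominated k))

exchange-bound₁ : ∀ {a b} {X₁ X₂ Y₁ Y₂ : Bool} → b ≤ a → bit Y₁ ≤ bit Y₂ →
                  bit Y₂ + (bit Y₁ + b) ≤ bit X₂ + (bit X₁ + a) → bit Y₁ + b ≤ bit X₂ + a
exchange-bound₁ {X₂ = X₂}    {Y₁ = false}             b≤a _  _    = ≤-trans b≤a (m≤n+m _ (bit X₂))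
exchange-bound₁ {X₂ = true}  {Y₁ = true}              b≤a _  _    = s≤s b≤a
exchange-bound₁ {a} {X₁ = X₁} {false} {true} {true}   _   _  both = s≤s⁻¹ (≤-trans both (+-monoˡ-≤ a (bit≤1 X₁)))
exchange-bound₁ {X₂ = false} {Y₁ = true} {false}      _   () _

exchange-bound₂ : ∀ {a b} {X₁ X₂ Y₁ Y₂ : Bool} → b ≤ a → bit X₂ ≤ bit X₁ →
                  bit Y₂ + (bit Y₁ + b) ≤ bit X₂ + (bit X₁ + a) → bit Y₂ + b ≤ bit X₁ + a
exchange-bound₂ {b = b} {true}  {Y₂ = Y₂}         b≤a _  _    = ≤-trans (+-monoˡ-≤ b (bit≤1 Y₂)) (s≤s b≤a)
exchange-bound₂ {b = b} {false} {false} {Y₁} {Y₂} _   _  both = ≤-trans (+-monoʳ-≤ (bit Y₂) (m≤n+m b (bit Y₁))) both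
exchange-bound₂ {X₁ = false} {true}               _   () _

≼-exchange : ∀ {n} {r : Fin n} {A B x₁ x₂ y₁ y₂} → A ≼[ r ] B → x₂ ∷ x₁ ∷ A ≼[ r ] y₂ ∷ y₁ ∷ B →
             x₁ <[ r ] x₂ → y₂ <[ r ] y₁ → (x₂ ∷ A ≼[ r ] y₁ ∷ B) × (x₁ ∷ A ≼[ r ] y₂ ∷ B)
≼-exchange (dominates |A|≡|B| A≼B) (dominates _ both) x₁<x₂ y₂<y₁ =
    dominates (cong suc |A|≡|B|) (λ k → exchange-bound₁ (A≼B k) (bit-<ᵇ-antitone k (<⇒≤ y₂<y₁)) (both k))
  , dominates (cong suc |A|≡|B|) (λ k → exchange-bound₂ (A≼B k) (bit-<ᵇ-antitone k (<⇒≤ x₁<x₂)) (both k))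

-- Cyclic ranks

%-cong-+ˡ : ∀ {n} .{{_ : NonZero n}} k {m m′} → m % n ≡ m′ % n → (k + m) % n ≡ (k + m′) % n
%-cong-+ˡ {n} k {m} {m′} eq = begin
  (k + m) % n           ≡⟨ %-distribˡ-+ k m n ⟩
  (k % n + m % n) % n   ≡⟨ cong (λ j → (k % n + j) % n) eq ⟩
  (k % n + m′ % n) % n  ≡⟨ %-distribˡ-+ k m′ n ⟨
  (k + m′) % n          ∎
  where open ≡-Reasoning

%-cancel-+ʳ : ∀ {n} .{{_ : NonZero n}} c {m m′} → (m + c) % n ≡ (m′ + c) % n → m % n ≡ m′ % n
%-cancel-+ʳ {n} c {m} {m′} eq = begin
  m % n                        ≡⟨ [m+kn]%n≡m%n m c n ⟨
  (m + c * n) % n              ≡⟨ cong (_% n) (complete m) ⟩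
  (pred n * c + (m + c)) % n   ≡⟨ %-cong-+ˡ (pred n * c) eq ⟩
  (pred n * c + (m′ + c)) % n  ≡⟨ cong (_% n) (complete m′) ⟨
  (m′ + c * n) % n             ≡⟨ [m+kn]%n≡m%n m′ c n ⟩
  m′ % n                       ∎
  where
  open ≡-Reasoning
  rearrange : ∀ m c k → m + c * suc k ≡ k * c + (m + c)
  rearrange = solve-∀
  complete : ∀ m → m + c * n ≡ pred n * c + (m + c)
  complete m = trans (cong (λ j → m + c * j) (sym (suc-pred n))) (rearrange m c (pred n))

-- x − c modulo n for x, c < n; rank r x unfolds to subMod n (toℕ x) (toℕ r).
subMod : ℕ → ℕ → ℕ → ℕ
subMod n x c = if c ≤ᵇ x then x ∸ c else x + n ∸ c

subMod-≥ : c ≤ x → subMod n x c ≡ x ∸ c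
subMod-≥ c≤x rewrite ≤ᵇ-true c≤x = refl

subMod-< : x < c → subMod n x c ≡ x + n ∸ c
subMod-< x<c rewrite ≤ᵇ-false x<c = refl

subMod<n : x < n → c ≤ n → subMod n x c < n
subMod<n {x} {n} {c} x<n c≤n with c ≤? x
... | yes c≤x rewrite subMod-≥ {n = n} c≤x = ≤-<-trans (m∸n≤m x c) x<n
... | no  c≰x rewrite subMod-< {n = n} (≰⇒> c≰x) = +-cancelʳ-< c _ n (begin-strict
  x + n ∸ c + c  ≡⟨ m∸n+n≡m (≤-trans c≤n (m≤n+m n x)) ⟩
  x + n          <⟨ +-monoˡ-< n (≰⇒> c≰x) ⟩
  c + n          ≡⟨ +-comm c n ⟩
  n + c          ∎)
  where open ≤-Reasoning

subMod-+-% : .{{_ : NonZero n}} → x < n → c ≤ n → (subMod n x c + c) % n ≡ x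
subMod-+-% {n} {x} {c} x<n c≤n with c ≤? x
... | yes c≤x rewrite subMod-≥ {n = n} c≤x | m∸n+n≡m c≤x = m<n⇒m%n≡m x<n
... | no  c≰x rewrite subMod-< {n = n} (≰⇒> c≰x) | m∸n+n≡m (≤-trans c≤n (m≤n+m n x)) =
  trans ([m+n]%n≡m%n x n) (m<n⇒m%n≡m x<n)

subMod-subMod : ∀ {n a r x} .{{_ : NonZero n}} → a < n → r < n → x < n →
                subMod n (subMod n x a) (subMod n r a) ≡ subMod n x r
subMod-subMod {n} {a} {r} {x} a<n r<n x<n = begin
  w      ≡⟨ m<n⇒m%n≡m w<n ⟨
  w % n  ≡⟨ %-cancel-+ʳ ρ (trans w+ρ≡α (sym z+ρ≡α)) ⟩
  z % n  ≡⟨ m<n⇒m%n≡m z<n ⟩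
  z      ∎
  where
  open ≡-Reasoning
  ρ = subMod n r a
  α = subMod n x a
  z = subMod n x r
  w = subMod n α ρ
  α<n = subMod<n x<n (<⇒≤ a<n)
  ρ≤n = <⇒≤ (subMod<n r<n (<⇒≤ a<n))
  z<n = subMod<n x<n (<⇒≤ r<n)
  w<n = subMod<n α<n ρ≤n
  w+ρ≡α : (w + ρ) % n ≡ α % n
  w+ρ≡α = trans (subMod-+-% α<n ρ≤n) (sym (m<n⇒m%n≡m α<n))
  z+ρ≡α : (z + ρ) % n ≡ α % n
  z+ρ≡α = %-cancel-+ʳ a (begin
    (z + ρ + a) % n    ≡⟨ cong (_% n) (+-assoc z ρ a) ⟩
    (z + (ρ + a)) % n  ≡⟨ %-cong-+ˡ z (trans (subMod-+-% r<n (<⇒≤ a<n)) (sym (m<n⇒m%n≡m r<n))) ⟩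
    (z + r) % n        ≡⟨ subMod-+-% x<n (<⇒≤ r<n) ⟩
    x                  ≡⟨ subMod-+-% x<n (<⇒≤ a<n) ⟨
    (α + a) % n        ∎)

subMod-<ᵇ-split : ∀ {n y ρ k} → ρ ≤ n → k ≤ n →
  bit (subMod n y ρ <ᵇ k) + bit (y <ᵇ ρ) ≡ bit (y <ᵇ k + ρ) + bit (y <ᵇ k + ρ ∸ n)
subMod-<ᵇ-split {n} {y} {ρ} {k} ρ≤n k≤n with ρ ≤? y
... | yes ρ≤y rewrite subMod-≥ {n = n} ρ≤y | m∸n<ᵇo≡m<ᵇo+n k ρ≤y | <ᵇ-false ρ≤y
                    | <ᵇ-false (≤-trans (m≤n+o⇒m∸n≤o (k + ρ) n (+-monoˡ-≤ ρ k≤n)) ρ≤y) = refl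
... | no  ρ≰y rewrite subMod-< {n = n} (≰⇒> ρ≰y) | m∸n<ᵇo≡m<ᵇo+n k (≤-trans ρ≤n (m≤n+m n y))
                    | m+n<ᵇo≡m<ᵇo∸n y n (k + ρ) | <ᵇ-true (≰⇒> ρ≰y)
                    | <ᵇ-true (≤-trans (≰⇒> ρ≰y) (m≤n+m ρ k)) = +-comm _ 1

rank<n : ∀ {n} (r x : Fin n) → rank r x < n
rank<n r x = subMod<n (toℕ<n x) (<⇒≤ (toℕ<n r))

subMod-rank : ∀ {n} (a r x : Fin n) → subMod n (rank a x) (rank a r) ≡ rank r x
subMod-rank {suc n} a r x = subMod-subMod (toℕ<n a) (toℕ<n r) (toℕ<n x)

rank-self : ∀ {n} (c : Fin n) → rank c c ≡ 0
rank-self {n} c = trans (subMod-≥ {c = toℕ c} {x = toℕ c} {n = n} ≤-refl) (n∸n≡0 (toℕ c))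

inCyc-rank : ∀ {n} (a r x : Fin n) → inCyc a r x ≡ (rank a x <ᵇ rank a r)
inCyc-rank {n} a r x with toℕ a ≤? toℕ r | toℕ a ≤? toℕ x
... | yes a≤r | yes a≤x rewrite ≤ᵇ-true a≤r | ≤ᵇ-true a≤x = sym (m∸o<ᵇn∸o≡m<ᵇn a≤x a≤r)
... | yes a≤r | no  a≰x rewrite ≤ᵇ-true a≤r | ≤ᵇ-false (≰⇒> a≰x) =
  sym (<ᵇ-false (∸-monoˡ-≤ (toℕ a) (≤-trans (<⇒≤ (toℕ<n r)) (m≤n+m n (toℕ x)))))
... | no  a≰r | yes a≤x rewrite ≤ᵇ-false (≰⇒> a≰r) | ≤ᵇ-true a≤x =
  sym (<ᵇ-true (∸-monoˡ-< (<-≤-trans (toℕ<n x) (m≤n+m n (toℕ r))) a≤x))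
... | no  a≰r | no  a≰x rewrite ≤ᵇ-false (≰⇒> a≰r) | ≤ᵇ-false (≰⇒> a≰x) = sym (trans
  (m∸o<ᵇn∸o≡m<ᵇn (≤-trans (<⇒≤ (toℕ<n a)) (m≤n+m n (toℕ x))) (≤-trans (<⇒≤ (toℕ<n a)) (m≤n+m n (toℕ r))))
  (m+o<ᵇn+o≡m<ᵇn (toℕ x) (toℕ r) n))

inCyc-self : ∀ {n} (c x : Fin n) → inCyc c c x ≡ false
inCyc-self c x = trans (inCyc-rank c c x) (cong (rank c x <ᵇ_) (rank-self c))

-- The first k elements of <_r together with [a, r)_c are the first k + rank a r elements of <_a,
-- those past the n-th wrapping around to be counted a second time.
rank-<ᵇ-split : ∀ {n} (a r : Fin n) {k} → k ≤ n → ∀ x →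
  bit (rank r x <ᵇ k) + bit (inCyc a r x) ≡ bit (rank a x <ᵇ k + rank a r) + bit (rank a x <ᵇ k + rank a r ∸ n)
rank-<ᵇ-split a r k≤n x rewrite inCyc-rank a r x | sym (subMod-rank a r x) =
  subMod-<ᵇ-split (<⇒≤ (rank<n a r)) k≤n

countBelow-⊓ : ∀ {n} (r : Fin n) k S → countBelow r (k ⊓ n) S ≡ countBelow r k S
countBelow-⊓ {n} r k = count-cong λ x →
  <ᵇ-cong (λ lt → <-≤-trans lt (m⊓n≤m k n)) (λ lt → ⊓-glb lt (rank<n r x))

countCyc-self : ∀ {n} (c : Fin n) S → countCyc c c S ≡ 0
countCyc-self c S = trans (length-filterᵇ (inCyc c c) S) (count-none (All.universal (inCyc-self c) S))

countCyc-↭ : ∀ {n} (a b : Fin n) {S S′} → S ↭ S′ → countCyc a b S ≡ countCyc a b S′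
countCyc-↭ a b S↭S′ = ↭-length (filter-↭ (T? ∘ inCyc a b) S↭S′)

≼-rotate : ∀ {n} {a r : Fin n} {S T} → S ≼[ a ] T → countCyc a r S ≡ countCyc a r T → S ≼[ r ] T
≼-rotate {n} {a} {r} {S} {T} (dominates |S|≡|T| dominated) cyc = dominates |S|≡|T| λ k →
  subst₂ _≤_ (countBelow-⊓ r k T) (countBelow-⊓ r k S) (dominated-≤n (k ⊓ n) (m⊓n≤n k n))
  where
  ρ = rank a r
  split : ∀ {k} → k ≤ n → ∀ U →
          countBelow r k U + countCyc a r U ≡ countBelow a (k + ρ) U + countBelow a (k + ρ ∸ n) U
  split k≤n U = trans (cong (_ +_) (length-filterᵇ (inCyc a r) U)) (count-+ (rank-<ᵇ-split a r k≤n) U)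
  dominated-≤n : ∀ k → k ≤ n → countBelow r k T ≤ countBelow r k S
  dominated-≤n k k≤n = +-cancelʳ-≤ (countCyc a r S) _ _ (begin
    countBelow r k T + countCyc a r S                    ≡⟨ cong (countBelow r k T +_) cyc ⟩
    countBelow r k T + countCyc a r T                    ≡⟨ split k≤n T ⟩
    countBelow a (k + ρ) T + countBelow a (k + ρ ∸ n) T  ≤⟨ +-mono-≤ (dominated (k + ρ)) (dominated (k + ρ ∸ n)) ⟩
    countBelow a (k + ρ) S + countBelow a (k + ρ ∸ n) S  ≡⟨ split k≤n S ⟨
    countBelow r k S + countCyc a r S                    ∎)
    where open ≤-Reasoning

-- Prefixes of permutations

transpose-matchˡ : ∀ {n} (i j : Fin n) → PC.transpose i j i ≡ j
transpose-matchˡ i j rewrite dec-true (i ≟ i) refl = refl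

take-tabulate-transpose-↭ : ∀ {m} (f : Fin (suc m) → A) (i : Fin m) k → k ≢ suc (toℕ i) →
  take k (tabulate (f ∘ PC.transpose (inject₁ i) (suc i))) ↭ take k (tabulate f)
take-tabulate-transpose-↭ f i       zero          _   = ↭-refl
take-tabulate-transpose-↭ f zero    (suc zero)    k≢1 = contradiction refl k≢1
take-tabulate-transpose-↭ f zero    (suc (suc k)) _   = swap _ _ ↭-refl
take-tabulate-transpose-↭ f (suc i) (suc k)       k≢  = prep (f zero) (↭-trans
  (↭-reflexive (cong (take k) (tabulate-cong (cong f ∘ lift₀-transpose (inject₁ i) (suc i) ∘ suc))))
  (take-tabulate-transpose-↭ (f ∘ suc) i k (k≢ ∘ cong suc)))

prefix-tabulate : ∀ {n} (w : Permutation′ n) k → prefix w k ≡ take k (tabulate (w ⟨$⟩ʳ_))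
prefix-tabulate w k = cong (take k) (map-tabulate (λ j → j) (w ⟨$⟩ʳ_))

prefix-suc-↭ : ∀ {n} (w : Permutation′ n) j → prefix w (suc (toℕ j)) ↭ (w ⟨$⟩ʳ j) ∷ prefix w (toℕ j)
prefix-suc-↭ w j rewrite prefix-tabulate w (suc (toℕ j)) | prefix-tabulate w (toℕ j) =
  ↭-trans (↭-reflexive (take-suc-tabulate (w ⟨$⟩ʳ_) j)) (++-comm _ [ w ⟨$⟩ʳ j ])

prefix-suc-suc-↭ : ∀ {n} (w : Permutation′ n) {p q} → toℕ q ≡ suc (toℕ p) →
                   prefix w (suc (toℕ q)) ↭ (w ⟨$⟩ʳ q) ∷ (w ⟨$⟩ʳ p) ∷ prefix w (toℕ p)
prefix-suc-suc-↭ w {p} {q} pq = begin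
  prefix w (suc (toℕ q))                      ↭⟨ prefix-suc-↭ w q ⟩
  (w ⟨$⟩ʳ q) ∷ prefix w (toℕ q)               ≡⟨ cong (λ k → (w ⟨$⟩ʳ q) ∷ prefix w k) pq ⟩
  (w ⟨$⟩ʳ q) ∷ prefix w (suc (toℕ p))         ↭⟨ prep _ (prefix-suc-↭ w p) ⟩
  (w ⟨$⟩ʳ q) ∷ (w ⟨$⟩ʳ p) ∷ prefix w (toℕ p)  ∎
  where open PermutationReasoning

prefix-swapPos-↭ : ∀ {n} (w : Permutation′ n) {p q} → toℕ q ≡ suc (toℕ p) →
                   ∀ k → k ≢ suc (toℕ p) → prefix (swapPos w p q) k ↭ prefix w k
prefix-swapPos-↭ w {p} {suc i} pq k k≢ with refl ← toℕ-injective (trans (toℕ-inject₁ i) (suc-injective pq))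
  rewrite prefix-tabulate (swapPos w (inject₁ i) (suc i)) k | prefix-tabulate w k =
  take-tabulate-transpose-↭ (w ⟨$⟩ʳ_) i k (k≢ ∘ λ k≡ → trans k≡ (cong suc (sym (toℕ-inject₁ i))))

prefix-swapPos-suc-↭ : ∀ {n} (w : Permutation′ n) {p q} → toℕ q ≡ suc (toℕ p) →
                       prefix (swapPos w p q) (suc (toℕ p)) ↭ (w ⟨$⟩ʳ q) ∷ prefix w (toℕ p)
prefix-swapPos-suc-↭ w {p} {q} pq = begin
  prefix w′ (suc (toℕ p))
    ↭⟨ prefix-suc-↭ w′ p ⟩
  (w ⟨$⟩ʳ PC.transpose p q p) ∷ prefix w′ (toℕ p)
    ≡⟨ cong (λ j → (w ⟨$⟩ʳ j) ∷ prefix w′ (toℕ p)) (transpose-matchˡ p q) ⟩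
  (w ⟨$⟩ʳ q) ∷ prefix w′ (toℕ p)
    ↭⟨ prep _ (prefix-swapPos-↭ w pq (toℕ p) (<⇒≢ (n<1+n (toℕ p)))) ⟩
  (w ⟨$⟩ʳ q) ∷ prefix w (toℕ p)
    ∎
  where
  open PermutationReasoning
  w′ = swapPos w p q

≲⇒≼-previous : ∀ {n} {u v : Permutation′ n} {a : Fin n → Fin n} → u ≲[ a ] v →
               ∀ p → prefix u (toℕ p) ≼[ a p ] prefix v (toℕ p)
≲⇒≼-previous _ zero = dominates refl (λ _ → z≤n)
≲⇒≼-previous {u = u} {v} {a} (gale , cyc) (suc p) =
  subst (λ k → prefix u k ≼[ a (suc p) ] prefix v k) (cong suc (toℕ-inject₁ p))
    (≼-rotate (≤ˢ⇒≼ (a (inject₁ p)) (gale (inject₁ p)))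
              (cyc (inject₁ p) (suc p) (cong suc (sym (toℕ-inject₁ p)))))

≲-update : ∀ {n} {u v u′ v′ : Permutation′ n} {a : Fin n → Fin n} {p q} →
           toℕ q ≡ suc (toℕ p) → a p ≡ a q → u ≲[ a ] v →
           (∀ k → k ≢ suc (toℕ p) → prefix u′ k ↭ prefix u k) →
           (∀ k → k ≢ suc (toℕ p) → prefix v′ k ↭ prefix v k) →
           prefix u′ (suc (toℕ p)) ≼[ a p ] prefix v′ (suc (toℕ p)) → u′ ≲[ a ] v′
≲-update {u = u} {v} {u′} {v′} {a} {p} {q} pq ap≡aq (gale , cyc) u′↭u v′↭v at-p = gale′ , cyc′
  where
  away : ∀ {p′} → p′ ≢ p → suc (toℕ p′) ≢ suc (toℕ p)
  away p′≢p = p′≢p ∘ toℕ-injective ∘ suc-injective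
  gale′ : ∀ p′ → prefix u′ (suc (toℕ p′)) ≤[ a p′ ]ˢ prefix v′ (suc (toℕ p′))
  gale′ p′ with p′ ≟ p
  ... | yes refl = ≼⇒≤ˢ at-p
  ... | no  p′≢p = ≼⇒≤ˢ (≼-resp-↭ (↭-sym (u′↭u _ (away p′≢p))) (↭-sym (v′↭v _ (away p′≢p)))
                                  (≤ˢ⇒≼ (a p′) (gale p′)))
  cyc′ : ∀ p′ q′ → toℕ q′ ≡ suc (toℕ p′) →
         countCyc (a p′) (a q′) (prefix u′ (suc (toℕ p′))) ≡ countCyc (a p′) (a q′) (prefix v′ (suc (toℕ p′)))
  cyc′ p′ q′ q′p′ with p′ ≟ p
  ... | yes refl rewrite toℕ-injective (trans q′p′ (sym pq)) | sym ap≡aq =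
    trans (countCyc-self (a p) (prefix u′ (suc (toℕ p)))) (sym (countCyc-self (a p) (prefix v′ (suc (toℕ p)))))
  ... | no  p′≢p = trans (countCyc-↭ (a p′) (a q′) (u′↭u _ (away p′≢p)))
                         (trans (cyc p′ q′ q′p′) (sym (countCyc-↭ (a p′) (a q′) (v′↭v _ (away p′≢p)))))

theorem3p23 : ∀ {n} (u v : Permutation′ n) (a : Fin n → Fin n) (p q : Fin n) →
    toℕ q ≡ suc (toℕ p) →
    u ≲[ a ] v → IsDes a v p q → IsAsc a u p q →
    (swapPos u p q ≲[ a ] v) × (u ≲[ a ] swapPos v p q)
theorem3p23 u v a p q pq u≲v (ap≡aq , v-descent) (_ , u-ascent) =
    ≲-update {u = u} {v} {swapPos u p q} {v} pq ap≡aq u≲v (prefix-swapPos-↭ u pq) (λ _ _ → ↭-refl)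
      (≼-resp-↭ (↭-sym (prefix-swapPos-suc-↭ u pq)) (↭-sym (prefix-suc-↭ v p)) (proj₁ exchanged))
  , ≲-update {u = u} {v} {u} {swapPos v p q} pq ap≡aq u≲v (λ _ _ → ↭-refl) (prefix-swapPos-↭ v pq)
      (≼-resp-↭ (↭-sym (prefix-suc-↭ u p)) (↭-sym (prefix-swapPos-suc-↭ v pq)) (proj₂ exchanged))
  where
  r = a p
  before : prefix u (toℕ p) ≼[ r ] prefix v (toℕ p)
  before = ≲⇒≼-previous {u = u} {v} {a} u≲v p
  after : (u ⟨$⟩ʳ q) ∷ (u ⟨$⟩ʳ p) ∷ prefix u (toℕ p) ≼[ r ] (v ⟨$⟩ʳ q) ∷ (v ⟨$⟩ʳ p) ∷ prefix v (toℕ p)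
  after = ≼-resp-↭ (prefix-suc-suc-↭ u pq) (prefix-suc-suc-↭ v pq) (≤ˢ⇒≼ r
    (subst (λ c → prefix u (suc (toℕ q)) ≤[ c ]ˢ prefix v (suc (toℕ q))) (sym ap≡aq) (proj₁ u≲v q)))
  exchanged = ≼-exchange before after u-ascent v-descent
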